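{- Let $G$ be a cactus graph on $n$ vertices with at least two cycles, containing a $4$-cycle, such that for every $4$-cycle $C$ of $G$ there are no two adjacent vertices of $C$ that each have a neighbor not on $C$. Then $\operatorname{Z}(\overline{G})=n-3$.
   Context: All graphs are finite, simple and undirected. A cactus graph is a connected graph in which any two simple cycles have at most one vertex in common. $\overline{G}$ denotes the complement of $G$ (same vertex set; distinct vertices adjacent iff not adjacent in $G$). Zero forcing: given an initial set $B\subseteq V(G)$ of blue vertices (all others white), a blue vertex with exactly one white neighbor may turn that neighbor blue; $B$ is a zero forcing set if repeated application makes all vertices blue. $\operatorname{Z}(G)$ is the minimum size of a zero forcing set of $G$. -}

module Defs where

open import Data.Nat using (ℕ; zero; suc; _≤_)
open import Data.Fin using (Fin; zero; suc; inject₁; fromℕ; _≟_)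
open import Data.Fin.Subset using (Subset; _∈_; ∣_∣)
open import Data.Bool using (Bool; true; false; not; _∧_)
open import Data.Bool.Properties using (∧-comm)
open import Data.Product using (Σ; ∃; _×_; _,_)
open import Data.Sum using (_⊎_)
open import Data.Empty using (⊥)
open import Relation.Nullary using (¬_; yes; no)
open import Relation.Nullary.Decidable using (isYes)
open import Relation.Binary.PropositionalEquality using (_≡_; refl; sym; cong)
open import Function.Definitions using (Injective)

record Graph (n : ℕ) : Set where
  field
    adj    : Fin n → Fin n → Bool
    adj-sym : ∀ u v → adj u v ≡ adj v u
    adj-irrefl : ∀ v → adj v v ≡ false
open Graph public

Adj : ∀ {n} → Graph n → Fin n → Fin n → Set
Adj G u v = adj G u v ≡ true

private
  neq : ∀ {n} → Fin n → Fin n → Bool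
  neq u v = not (isYes (u ≟ v))

  neq-sym : ∀ {n} (u v : Fin n) → neq u v ≡ neq v u
  neq-sym u v with u ≟ v | v ≟ u
  ... | yes _ | yes _ = refl
  ... | no _  | no _  = refl
  ... | yes p | no q  with q (sym p)
  ... | ()
  neq-sym u v | no q | yes p with q (sym p)
  ... | ()

  neq-refl : ∀ {n} (v : Fin n) → neq v v ≡ false
  neq-refl v with v ≟ v
  ... | yes _ = refl
  ... | no q with q refl
  ... | ()

complement : ∀ {n} → Graph n → Graph n
complement G = record
  { adj    = λ u v → not (adj G u v) ∧ neq u v
  ; adj-sym = λ u v → helper u v
  ; adj-irrefl = λ v → irr v
  }
  where
    helper : ∀ u v → (not (adj G u v) ∧ neq u v) ≡ (not (adj G v u) ∧ neq v u)
    helper u v rewrite Graph.adj-sym G u v | neq-sym u v = refl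
    irr : ∀ v → (not (adj G v v) ∧ neq v v) ≡ false
    irr v rewrite neq-refl v = ∧-comm (not (adj G v v)) false

data Reach {n} (G : Graph n) : Fin n → Fin n → Set where
  here : ∀ {u} → Reach G u u
  step : ∀ {u v w} → Adj G u v → Reach G v w → Reach G u w

Connected : ∀ {n} → Graph n → Set
Connected G = ∀ u v → Reach G u v

record Cycle {n} (G : Graph n) : Set where
  field
    m      : ℕ
    len≥3  : 3 ≤ suc m
    vert   : Fin (suc m) → Fin n
    inj    : Injective _≡_ _≡_ vert
    path   : ∀ (i : Fin m) → Adj G (vert (inject₁ i)) (vert (suc i))
    close  : Adj G (vert (fromℕ m)) (vert zero)
open Cycle public

len : ∀ {n} {G : Graph n} → Cycle G → ℕ
len C = suc (m C)

_∈C_ : ∀ {n} {G : Graph n} → Fin n → Cycle G → Set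
x ∈C C = ∃ λ i → vert C i ≡ x

CycEdge : ∀ {n} {G : Graph n} → Cycle G → Fin n → Fin n → Set
CycEdge C u v =
  (∃ λ (i : Fin (m C)) →
     (vert C (inject₁ i) ≡ u × vert C (suc i) ≡ v) ⊎ (vert C (inject₁ i) ≡ v × vert C (suc i) ≡ u))
  ⊎ ((vert C (fromℕ (m C)) ≡ u × vert C zero ≡ v) ⊎ (vert C (fromℕ (m C)) ≡ v × vert C zero ≡ u))

-- two cycles are the same (as subgraphs) iff they have the same edge set
SameCycle : ∀ {n} {G : Graph n} → Cycle G → Cycle G → Set
SameCycle C D = ∀ u v → (CycEdge C u v → CycEdge D u v) × (CycEdge D u v → CycEdge C u v)

Cactus : ∀ {n} → Graph n → Set
Cactus G = Connected G ×
  ((C D : Cycle G) → ¬ SameCycle C D →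
     ∀ x y → x ∈C C → x ∈C D → y ∈C C → y ∈C D → x ≡ y)

AtLeastTwoCycles : ∀ {n} → Graph n → Set
AtLeastTwoCycles G = Σ (Cycle G) λ C → Σ (Cycle G) λ D → ¬ SameCycle C D

Has4Cycle : ∀ {n} → Graph n → Set
Has4Cycle G = Σ (Cycle G) λ C → len C ≡ 4

FourCycleCondition : ∀ {n} → Graph n → Set
FourCycleCondition G = (C : Cycle G) → len C ≡ 4 →
  ¬ (Σ _ λ x → Σ _ λ y → x ∈C C × y ∈C C × Adj G x y ×
       (∃ λ a → Adj G x a × ¬ (a ∈C C)) × (∃ λ b → Adj G y b × ¬ (b ∈C C)))

-- Zero forcing: the set of vertices that eventually become blue from B
-- (the final colouring of the forcing process; it is independent of the order of forces)
data Blue {n} (G : Graph n) (B : Subset n) : Fin n → Set where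
  initial : ∀ {v} → v ∈ B → Blue G B v
  force   : ∀ {u v} → Blue G B u → Adj G u v →
            (∀ w → Adj G u w → ¬ (w ≡ v) → Blue G B w) → Blue G B v

IsZeroForcingSet : ∀ {n} → Graph n → Subset n → Set
IsZeroForcingSet G B = ∀ v → Blue G B v

ZeroForcingNumber : ∀ {n} → Graph n → ℕ → Set
ZeroForcingNumber G k =
  (Σ (Subset _) λ B → IsZeroForcingSet G B × ∣ B ∣ ≡ k)
  × (∀ B → IsZeroForcingSet G B → k ≤ ∣ B ∣)

-- Upper bound: as G is connected and has a second cycle, some vertex p of the 4-cycle has a
-- neighbour y off it; the cactus property then yields a zero forcing set V ∖ {p, r, y} of the
-- complement (r the vertex of the 4-cycle opposite p).
-- Lower bound (which only needs the 4-cycle condition): a vertex forcing in the complement is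
-- adjacent in G to every white vertex but the forced one. With four white vertices, three
-- successive first forces exhibit a 4-cycle of G with two adjacent vertices that both have a
-- neighbour off it.

module Submission where

open import Defs
open import Data.Bool using (true; false)
import Data.Bool as Bool
open import Data.Empty using (⊥; ⊥-elim)
open import Data.Fin using (Fin; zero; suc; inject₁; fromℕ; #_; _≟_)
open import Data.Fin.Properties using (any?)
open import Data.Fin.Subset using (Subset; inside; outside; _∈_; _∉_; _⊆_; _∪_; _-_; ⁅_⁆; ⊤; ∣_∣)
open import Data.Fin.Subset.Properties
  using ( _∈?_; drop-there; ∈⊤; ∣⊤∣≡n; x∈⁅x⁆; p⊆p∪q; x∈p∪q⁺; ∪-identityʳ
        ; x∈p∧x≢y⇒x∈p-y; x∈p⇒∣p-x∣<∣p∣)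
open import Data.Nat using (ℕ; zero; suc; _+_; _∸_; _≤_; _<_; z≤n; s≤s)
open import Data.Nat.Properties
  using ( ≤-trans; ≤-antisym; ≤-reflexive; ≤-<-trans; n≤1+n; m≤n+m; +-monoʳ-≤; +-suc; ≮⇒≥
        ; m≤n+o⇒m∸n≤o; m+n∸m≡n; ∸-monoˡ-≤; module ≤-Reasoning)
open import Data.Product using (∃; ∃₂; _×_; _,_; proj₁; proj₂)
import Data.Product as Product
open import Data.Sum using (_⊎_; inj₁; inj₂)
open import Data.Vec using (Vec; _∷_; []; lookup; tabulate)
open import Data.Vec.Properties using (lookup∘tabulate)
open import Data.Vec.Relation.Unary.All using (All; _∷_; [])
open import Data.Vec.Relation.Unary.All.Properties using (lookup⁺)
open import Data.Vec.Relation.Unary.AllPairs using (_∷_; [])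
open import Data.Vec.Relation.Unary.Unique.Propositional using (Unique)
open import Data.Vec.Relation.Unary.Unique.Propositional.Properties using (lookup-injective)
open import Function using (_∘_)
open import Relation.Binary.PropositionalEquality
  using (_≡_; _≢_; refl; sym; trans; cong; subst; ≢-sym)
open import Relation.Nullary using (¬_; Dec; yes; no; contradiction)
open import Relation.Nullary.Decidable using (_×-dec_; ¬?; decidable-stable)
open import Relation.Unary using (Decidable)

private
  variable
    n : ℕ
    G H : Graph n
    B B′ : Subset n
    u v w x : Fin n

Adj? : (G : Graph n) (u v : Fin n) → Dec (Adj G u v)
Adj? G u v = adj G u v Bool.≟ true

Adj-sym : (G : Graph n) → Adj G u v → Adj G v u
Adj-sym G uv = trans (adj-sym G _ _) uv

Adj-irrefl : (G : Graph n) → ¬ Adj G v v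
Adj-irrefl G vv with () ← trans (sym vv) (adj-irrefl G _)

Adjᶜ⁻ : (G : Graph n) → Adj (complement G) u v → ¬ Adj G u v
Adjᶜ⁻ G uvᶜ uv rewrite uv with () ← uvᶜ

Adjᶜ⁺ : (G : Graph n) → u ≢ v → ¬ Adj G u v → Adj (complement G) u v
Adjᶜ⁺ {u = u} {v} G u≢v ¬uv with adj G u v | u ≟ v
... | true  | _        = contradiction refl ¬uv
... | false | yes u≡v  = contradiction u≡v u≢v
... | false | no _     = refl

¬Adjᶜ⇒Adj : (G : Graph n) → u ≢ v → ¬ Adj (complement G) u v → Adj G u v
¬Adjᶜ⇒Adj {u = u} {v} G u≢v ¬uvᶜ = decidable-stable (Adj? G u v) (¬uvᶜ ∘ Adjᶜ⁺ G u≢v)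

∈∉⇒≢ : u ∈ B → v ∉ B → u ≢ v
∈∉⇒≢ u∈B v∉B refl = v∉B u∈B

∈∪⁅⁆ : v ∈ B ∪ ⁅ v ⁆
∈∪⁅⁆ = x∈p∪q⁺ (inj₂ (x∈⁅x⁆ _))

∉∪⁅⁆ : w ∉ B ∪ ⁅ v ⁆ → w ∉ B × w ≢ v
∉∪⁅⁆ w∉ = w∉ ∘ x∈p∪q⁺ ∘ inj₁ , λ { refl → w∉ ∈∪⁅⁆ }

∣p∣<n⇒∃∉ : {p : Subset n} → ∣ p ∣ < n → ∃ (_∉ p)
∣p∣<n⇒∃∉ {p = outside ∷ p} _ = zero , λ ()
∣p∣<n⇒∃∉ {p = inside ∷ p} (s≤s |p|<n) = Product.map suc (_∘ drop-there) (∣p∣<n⇒∃∉ |p|<n)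

∣p∪⁅x⁆∣≤1+∣p∣ : (p : Subset n) (x : Fin n) → ∣ p ∪ ⁅ x ⁆ ∣ ≤ suc ∣ p ∣
∣p∪⁅x⁆∣≤1+∣p∣ (outside ∷ p) zero    = s≤s (≤-reflexive (cong ∣_∣ (∪-identityʳ p)))
∣p∪⁅x⁆∣≤1+∣p∣ (inside ∷ p)  zero    =
  s≤s (≤-trans (≤-reflexive (cong ∣_∣ (∪-identityʳ p))) (n≤1+n _))
∣p∪⁅x⁆∣≤1+∣p∣ (outside ∷ p) (suc x) = ∣p∪⁅x⁆∣≤1+∣p∣ p x
∣p∪⁅x⁆∣≤1+∣p∣ (inside ∷ p)  (suc x) = s≤s (∣p∪⁅x⁆∣≤1+∣p∣ p x)

-- k + ∣ B ∣ < n says that at least k + 1 vertices lie outside B.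
outside-∪⁅⁆ : (k : ℕ) (B : Subset n) (v : Fin n) → suc k + ∣ B ∣ < n → k + ∣ B ∪ ⁅ v ⁆ ∣ < n
outside-∪⁅⁆ {n} k B v k+1-outside =
  ≤-<-trans (+-monoʳ-≤ k (∣p∪⁅x⁆∣≤1+∣p∣ B v)) (subst (_< n) (sym (+-suc k ∣ B ∣)) k+1-outside)

Blue-mono : B ⊆ B′ → Blue H B v → Blue H B′ v
Blue-mono B⊆B′ (initial v∈B)         = initial (B⊆B′ v∈B)
Blue-mono B⊆B′ (force u uv othersBlue) =
  force (Blue-mono B⊆B′ u) uv (λ w uw w≢v → Blue-mono B⊆B′ (othersBlue w uw w≢v))

IsZeroForcingSet-∪ : (p : Subset n) → IsZeroForcingSet H B → IsZeroForcingSet H (B ∪ p)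
IsZeroForcingSet-∪ p zfs v = Blue-mono (p⊆p∪q p) (zfs v)

record Force (H : Graph n) (B : Subset n) : Set where
  field
    forcer forced : Fin n
    forcer∈ : forcer ∈ B
    forced∉ : forced ∉ B
    forces  : Adj H forcer forced
    othersIn : ∀ w → Adj H forcer w → w ≢ forced → w ∈ B

otherNeighbours? : (H : Graph n) (B : Subset n) (u v : Fin n) →
  (∀ w → Adj H u w → w ≢ v → w ∈ B) ⊎ ∃ λ w → Adj H u w × w ≢ v × w ∉ B
otherNeighbours? H B u v with any? (λ w → Adj? H u w ×-dec ¬? (w ≟ v) ×-dec ¬? (w ∈? B))
... | yes outsider = inj₂ outsider
... | no ¬outsider =
  inj₁ λ w uw w≢v → decidable-stable (w ∈? B) (λ w∉B → ¬outsider (w , uw , w≢v , w∉B))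

-- A derivation of a vertex outside B contains a first force, performed from B itself.
Blue⇒Force : Blue H B v → v ∉ B → Force H B
Blue⇒Force (initial v∈B) v∉B = contradiction v∈B v∉B
Blue⇒Force {H = H} {B = B} {v = v} (force {u = u} blueU uv othersBlue) v∉B with u ∈? B
... | no u∉B = Blue⇒Force blueU u∉B
... | yes u∈B with otherNeighbours? H B u v
...   | inj₁ othersIn             =
  record { forcer∈ = u∈B ; forced∉ = v∉B ; forces = uv ; othersIn = othersIn }
...   | inj₂ (w , uw , w≢v , w∉B) = Blue⇒Force (othersBlue w uw w≢v) w∉B

firstForce : {B : Subset n} → IsZeroForcingSet H B → ∣ B ∣ < n → Force H B
firstForce zfs |B|<n with w , w∉B ← ∣p∣<n⇒∃∉ |B|<n = Blue⇒Force (zfs w) w∉B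

AdjToAllOutside : Graph n → Subset n → Fin n → Set
AdjToAllOutside G B u = ∀ w → w ∉ B → Adj G u w

AdjToAllOutside-mono : B ⊆ B′ → AdjToAllOutside G B u → AdjToAllOutside G B′ u
AdjToAllOutside-mono B⊆B′ uB w w∉B′ = uB w (w∉B′ ∘ B⊆B′)

forcerᶜ-adjToAllOutside : (f : Force (complement G) B) →
  AdjToAllOutside G (B ∪ ⁅ Force.forced f ⁆) (Force.forcer f)
forcerᶜ-adjToAllOutside {G = G} f w w∉ with w∉B , w≢v ← ∉∪⁅⁆ w∉ =
  ¬Adjᶜ⇒Adj G (∈∉⇒≢ forcer∈ w∉B) (λ uwᶜ → w∉B (othersIn w uwᶜ w≢v))
  where open Force f

cycleOf : {m : ℕ} (vs : Vec (Fin n) (suc (suc (suc m)))) → Unique vs →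
  (∀ i → Adj G (lookup vs (inject₁ i)) (lookup vs (suc i))) →
  Adj G (lookup vs (fromℕ _)) (lookup vs zero) → Cycle G
cycleOf vs distinct path close = record
  { m = _ ; len≥3 = s≤s (s≤s (s≤s z≤n)) ; vert = lookup vs ; inj = lookup-injective distinct _ _
  ; path = path ; close = close }

∉C : (C : Cycle G) → All (x ≢_) (tabulate (vert C)) → ¬ x ∈C C
∉C C x∉C (i , vᵢ≡x) = lookup⁺ x∉C i (trans (sym vᵢ≡x) (sym (lookup∘tabulate (vert C) i)))

triangle : {a b c : Fin n} → Unique (a ∷ b ∷ c ∷ []) →
  Adj G a b → Adj G b c → Adj G c a → Cycle G
triangle distinct ab bc ca = cycleOf _ distinct (λ { zero → ab ; (suc zero) → bc }) ca

square : {a b c d : Fin n} → Unique (a ∷ b ∷ c ∷ d ∷ []) →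
  Adj G a b → Adj G b c → Adj G c d → Adj G d a → Cycle G
square distinct ab bc cd da =
  cycleOf _ distinct (λ { zero → ab ; (suc zero) → bc ; (suc (suc zero)) → cd }) da

module _ {n : ℕ} {G : Graph n} (fcc : FourCycleCondition G) where

  -- One more force leaves a white vertex a, and u a u′ forced is a 4-cycle of G on which
  -- u has the neighbour c and a has the neighbour forcer off the cycle.
  twoOutside-⊥ : {B : Subset n} {u u′ c : Fin n} →
    IsZeroForcingSet (complement G) B → 1 + ∣ B ∣ < n →
    u ∈ B → u′ ∈ B → u ≢ u′ → AdjToAllOutside G B u → AdjToAllOutside G B u′ →
    c ∈ B → Adj G u c → c ≢ u′ → ⊥
  twoOutside-⊥ {B} {u} {u′} {c} zfs 1+∣B∣<n u∈B u′∈B u≢u′ uB u′B c∈B uc c≢u′ =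
    fcc C refl (u , a , (zero , refl) , (suc zero , refl) , uB a a∉B ,
                (c , uc , ∉C C (c≢u ∷ ∈∉⇒≢ c∈B a∉B ∷ c≢u′ ∷ ∈∉⇒≢ c∈B forced∉ ∷ [])) ,
                (forcer , Adj-sym G (forcerᶜ-adjToAllOutside f a a∉) ,
                 ∉C C (forcer≢ uB ∷ ∈∉⇒≢ forcer∈ a∉B ∷ forcer≢ u′B ∷ ∈∉⇒≢ forcer∈ forced∉ ∷ [])))
    where
    f = firstForce zfs (≤-<-trans (n≤1+n _) 1+∣B∣<n)
    open Force f
    outsider : ∃ (_∉ B ∪ ⁅ forced ⁆)
    outsider = ∣p∣<n⇒∃∉ (outside-∪⁅⁆ 0 B forced 1+∣B∣<n)
    a : Fin n
    a = proj₁ outsider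
    a∉ : a ∉ B ∪ ⁅ forced ⁆
    a∉ = proj₂ outsider
    a∉B : a ∉ B
    a∉B = proj₁ (∉∪⁅⁆ a∉)
    C : Cycle G
    C = square ((∈∉⇒≢ u∈B a∉B ∷ u≢u′ ∷ ∈∉⇒≢ u∈B forced∉ ∷ []) ∷
                (≢-sym (∈∉⇒≢ u′∈B a∉B) ∷ proj₂ (∉∪⁅⁆ a∉) ∷ []) ∷
                (∈∉⇒≢ u′∈B forced∉ ∷ []) ∷ [] ∷ [])
               (uB a a∉B) (Adj-sym G (u′B a a∉B))
               (u′B forced forced∉) (Adj-sym G (uB forced forced∉))
    c≢u : c ≢ u
    c≢u refl = Adj-irrefl G uc
    forcer≢ : {x : Fin n} → AdjToAllOutside G B x → forcer ≢ x
    forcer≢ xB refl = Adjᶜ⁻ G forces (xB forced forced∉)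

  threeOutside-⊥ : {B : Subset n} {u : Fin n} → IsZeroForcingSet (complement G) B → 2 + ∣ B ∣ < n →
    u ∈ B → AdjToAllOutside G B u → ⊥
  threeOutside-⊥ {B} {u} zfs 2+∣B∣<n u∈B uB =
    twoOutside-⊥ (IsZeroForcingSet-∪ ⁅ forced ⁆ zfs) (outside-∪⁅⁆ 1 B forced 2+∣B∣<n)
      (p⊆p∪q _ u∈B) (p⊆p∪q _ forcer∈) u≢forcer
      (AdjToAllOutside-mono {G = G} (p⊆p∪q _) uB) (forcerᶜ-adjToAllOutside f)
      ∈∪⁅⁆ (uB forced forced∉) forced≢forcer
    where
    f = firstForce zfs (≤-<-trans (m≤n+m _ 2) 2+∣B∣<n)
    open Force f
    u≢forcer : u ≢ forcer
    u≢forcer refl = Adjᶜ⁻ G forces (uB forced forced∉)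
    forced≢forcer : forced ≢ forcer
    forced≢forcer eq = Adj-irrefl (complement G) (subst (Adj (complement G) forcer) eq forces)

  fourOutside-⊥ : {B : Subset n} → IsZeroForcingSet (complement G) B → 3 + ∣ B ∣ < n → ⊥
  fourOutside-⊥ {B} zfs 3+∣B∣<n =
    threeOutside-⊥ (IsZeroForcingSet-∪ ⁅ forced ⁆ zfs) (outside-∪⁅⁆ 2 B forced 3+∣B∣<n)
      (p⊆p∪q _ forcer∈) (forcerᶜ-adjToAllOutside f)
    where
    f = firstForce zfs (≤-<-trans (m≤n+m _ 3) 3+∣B∣<n)
    open Force f

  complement-zeroForcing-lowerBound : (B : Subset n) → IsZeroForcingSet (complement G) B →
    n ∸ 3 ≤ ∣ B ∣
  complement-zeroForcing-lowerBound B zfs = m≤n+o⇒m∸n≤o n 3 (≮⇒≥ (fourOutside-⊥ zfs))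

cycleEdge⇒∈C : (C : Cycle G) → CycEdge C u v → v ∈C C
cycleEdge⇒∈C C (inj₁ (i , inj₁ (_ , e))) = suc i , e
cycleEdge⇒∈C C (inj₁ (i , inj₂ (e , _))) = inject₁ i , e
cycleEdge⇒∈C C (inj₂ (inj₁ (_ , e)))     = zero , e
cycleEdge⇒∈C C (inj₂ (inj₂ (e , _)))     = fromℕ (m C) , e

∈C⇒cycleEdge : (C : Cycle G) → v ∈C C → ∃ λ u → CycEdge C u v
∈C⇒cycleEdge C (zero , e)  = _ , inj₂ (inj₁ (refl , e))
∈C⇒cycleEdge C (suc i , e) = _ , inj₁ (i , inj₁ (refl , e))

SameCycle⇒∈C : (C D : Cycle G) → SameCycle C D → v ∈C C → v ∈C D
SameCycle⇒∈C C D same v∈C with u , uv ← ∈C⇒cycleEdge C v∈C = cycleEdge⇒∈C D (proj₁ (same u _) uv)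

cactus-sharedPair : Cactus G → (C D : Cycle G) → w ∈C C → ¬ w ∈C D →
  u ∈C C → u ∈C D → v ∈C C → v ∈C D → u ≡ v
cactus-sharedPair (_ , cyclesMeet) C D w∈C w∉D =
  cyclesMeet C D (λ same → w∉D (SameCycle⇒∈C C D same w∈C)) _ _

∈C? : (C : Cycle G) → Decidable (_∈C C)
∈C? C x = any? (λ i → vert C i ≟ x)

cycle-twoVertices : (C : Cycle G) → ∃₂ λ x y → x ≢ y × x ∈C C × y ∈C C
cycle-twoVertices record { m = zero ; len≥3 = s≤s () }
cycle-twoVertices record { m = suc _ ; inj = inj } =
  _ , _ , (λ e → contradiction (inj e) λ ()) , (zero , refl) , (suc zero , refl)

SameCycle-sym : (C D : Cycle G) → SameCycle C D → SameCycle D C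
SameCycle-sym C D C≈D u v = Product.swap (C≈D u v)

SameCycle-trans : (C D E : Cycle G) → SameCycle C D → SameCycle D E → SameCycle C E
SameCycle-trans C D E C≈D D≈E u v =
  proj₁ (D≈E u v) ∘ proj₁ (C≈D u v) , proj₂ (C≈D u v) ∘ proj₂ (D≈E u v)

-- A cycle through every vertex would share two vertices with every other cycle.
cactus-offCycleVertex : Cactus G → AtLeastTwoCycles G → (C : Cycle G) → ∃ λ z → ¬ z ∈C C
cactus-offCycleVertex {G = G} (_ , cyclesMeet) (C₁ , C₂ , C₁≁C₂) C with any? (¬? ∘ ∈C? C)
... | yes off = off
... | no ¬off = ⊥-elim (sameAs C₁ λ C≈C₁ → sameAs C₂ λ C≈C₂ →
                  C₁≁C₂ (SameCycle-trans C₁ C C₂ (SameCycle-sym C C₁ C≈C₁) C≈C₂))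
  where
  covers : ∀ z → z ∈C C
  covers z = decidable-stable (∈C? C z) (¬off ∘ (z ,_))
  sameAs : (D : Cycle G) → ¬ ¬ SameCycle C D
  sameAs D C≁D with x , y , x≢y , x∈D , y∈D ← cycle-twoVertices D =
    x≢y (cyclesMeet C D C≁D x y (covers x) x∈D (covers y) y∈D)

Reach-exit : {P : Fin n → Set} → Decidable P → Reach G u v → P u → ¬ P v →
  ∃₂ λ x y → P x × ¬ P y × Adj G x y
Reach-exit P? here         Pu ¬Pv = contradiction Pu ¬Pv
Reach-exit P? (step uw wv) Pu ¬Pv with P? _
... | yes Pw = Reach-exit P? wv Pw ¬Pv
... | no ¬Pw = _ , _ , Pu , ¬Pw , uw

cactus-cycleExit : Cactus G → AtLeastTwoCycles G → (C : Cycle G) →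
  ∃₂ λ i y → ¬ y ∈C C × Adj G (vert C i) y
cactus-cycleExit {G = G} cactus twoCycles C
  with z , z∉C ← cactus-offCycleVertex cactus twoCycles C
  with _ , y , (i , refl) , y∉C , py ←
         Reach-exit (∈C? C) (proj₁ cactus (vert C zero) z) (zero , refl) z∉C
  = i , y , y∉C , py

module _ {n : ℕ} {G : Graph n} (cactus : Cactus G) (C : Cycle G) where

  -- With p q r consecutive on C, a fourth vertex s of C and a neighbour y of p off C,
  -- the cactus property forbids the edges pr, qy and ry, so in the complement
  -- V ∖ {p, r, y} forces q → y → r → p.
  cactus-complement-zeroForcingSet : {i j k l : Fin (len C)} →
    i ≢ j → i ≢ k → i ≢ l → j ≢ k → j ≢ l → k ≢ l →
    Adj G (vert C i) (vert C j) → Adj G (vert C j) (vert C k) →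
    {y : Fin n} → ¬ y ∈C C → Adj G (vert C i) y →
    ∃ λ Z → IsZeroForcingSet (complement G) Z × ∣ Z ∣ ≤ n ∸ 3
  cactus-complement-zeroForcingSet {i} {j} {k} {l} i≢j i≢k i≢l j≢k j≢l k≢l pq qr {y} y∉C py =
    Z , zfs , size
    where
    p q r s : Fin n
    p = vert C i
    q = vert C j
    r = vert C k
    s = vert C l
    Gᶜ : Graph n
    Gᶜ = complement G

    vert-≢ : {a b : Fin (len C)} → a ≢ b → vert C a ≢ vert C b
    vert-≢ a≢b = a≢b ∘ inj C
    y≢ : (a : Fin (len C)) → y ≢ vert C a
    y≢ a e = y∉C (a , sym e)

    notThroughPQ : (D : Cycle G) → p ∈C D → q ∈C D → ¬ s ∈C D → ⊥
    notThroughPQ D p∈D q∈D s∉D =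
      vert-≢ i≢j (cactus-sharedPair cactus C D (l , refl) s∉D (i , refl) p∈D (j , refl) q∈D)

    ¬pr : ¬ Adj G p r
    ¬pr pr = notThroughPQ T (zero , refl) (suc zero , refl)
      (∉C T (vert-≢ (≢-sym i≢l) ∷ vert-≢ (≢-sym j≢l) ∷ vert-≢ (≢-sym k≢l) ∷ []))
      where
      T = triangle ((vert-≢ i≢j ∷ vert-≢ i≢k ∷ []) ∷ (vert-≢ j≢k ∷ []) ∷ [] ∷ [])
                   pq qr (Adj-sym G pr)

    ¬qy : ¬ Adj G q y
    ¬qy qy = notThroughPQ T (zero , refl) (suc zero , refl)
      (∉C T (vert-≢ (≢-sym i≢l) ∷ vert-≢ (≢-sym j≢l) ∷ ≢-sym (y≢ l) ∷ []))
      where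
      T = triangle ((vert-≢ i≢j ∷ ≢-sym (y≢ i) ∷ []) ∷ (≢-sym (y≢ j) ∷ []) ∷ [] ∷ [])
                   pq qy (Adj-sym G py)

    ¬ry : ¬ Adj G r y
    ¬ry ry = notThroughPQ S (zero , refl) (suc zero , refl)
      (∉C S (vert-≢ (≢-sym i≢l) ∷ vert-≢ (≢-sym j≢l) ∷ vert-≢ (≢-sym k≢l) ∷ ≢-sym (y≢ l) ∷ []))
      where
      S = square ((vert-≢ i≢j ∷ vert-≢ i≢k ∷ ≢-sym (y≢ i) ∷ []) ∷ (vert-≢ j≢k ∷ ≢-sym (y≢ j) ∷ []) ∷
                  (≢-sym (y≢ k) ∷ []) ∷ [] ∷ [])
                 pq qr ry (Adj-sym G py)

    Z : Subset n
    Z = ⊤ - p - r - y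

    ∈Z : w ≢ p → w ≢ r → w ≢ y → w ∈ Z
    ∈Z w≢p w≢r w≢y = x∈p∧x≢y⇒x∈p-y (x∈p∧x≢y⇒x∈p-y (x∈p∧x≢y⇒x∈p-y ∈⊤ w≢p) w≢r) w≢y

    r∈⊤-p : r ∈ ⊤ - p
    r∈⊤-p = x∈p∧x≢y⇒x∈p-y ∈⊤ (vert-≢ (≢-sym i≢k))
    y∈⊤-p-r : y ∈ ⊤ - p - r
    y∈⊤-p-r = x∈p∧x≢y⇒x∈p-y (x∈p∧x≢y⇒x∈p-y ∈⊤ (y≢ i)) (y≢ k)

    size : ∣ Z ∣ ≤ n ∸ 3
    size = subst (_≤ n ∸ 3) (m+n∸m≡n 3 ∣ Z ∣) (∸-monoˡ-≤ 3 threeRemoved)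
      where
      threeRemoved : 3 + ∣ Z ∣ ≤ n
      threeRemoved = begin
        3 + ∣ Z ∣          ≤⟨ s≤s (s≤s (x∈p⇒∣p-x∣<∣p∣ y∈⊤-p-r)) ⟩
        2 + ∣ ⊤ - p - r ∣  ≤⟨ s≤s (x∈p⇒∣p-x∣<∣p∣ r∈⊤-p) ⟩
        1 + ∣ ⊤ - p ∣      ≤⟨ x∈p⇒∣p-x∣<∣p∣ (∈⊤ {x = p}) ⟩
        ∣ ⊤ {n} ∣          ≡⟨ ∣⊤∣≡n n ⟩
        n                  ∎
        where open ≤-Reasoning

    blueUnlessPRY : ∀ w → (w ≡ p → Blue Gᶜ Z w) → (w ≡ r → Blue Gᶜ Z w) → (w ≡ y → Blue Gᶜ Z w) →
      Blue Gᶜ Z w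
    blueUnlessPRY w bp br by with w ≟ p | w ≟ r | w ≟ y
    ... | yes w≡p | _        | _        = bp w≡p
    ... | no _    | yes w≡r  | _        = br w≡r
    ... | no _    | no _     | yes w≡y  = by w≡y
    ... | no w≢p  | no w≢r   | no w≢y   = initial (∈Z w≢p w≢r w≢y)

    blueY : Blue Gᶜ Z y
    blueY = force (initial (∈Z (vert-≢ (≢-sym i≢j)) (vert-≢ j≢k) (≢-sym (y≢ j))))
      (Adjᶜ⁺ G (≢-sym (y≢ j)) ¬qy)
      λ w qw w≢y → blueUnlessPRY w (λ { refl → ⊥-elim (Adjᶜ⁻ G qw (Adj-sym G pq)) })
                                   (λ { refl → ⊥-elim (Adjᶜ⁻ G qw qr) }) (⊥-elim ∘ w≢y)

    blueR : Blue Gᶜ Z r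
    blueR = force blueY (Adjᶜ⁺ G (y≢ k) (¬ry ∘ Adj-sym G))
      λ w yw w≢r → blueUnlessPRY w (λ { refl → ⊥-elim (Adjᶜ⁻ G yw (Adj-sym G py)) })
                                   (⊥-elim ∘ w≢r) (λ { refl → ⊥-elim (Adj-irrefl Gᶜ yw) })

    blueP : Blue Gᶜ Z p
    blueP = force blueR (Adjᶜ⁺ G (vert-≢ (≢-sym i≢k)) (¬pr ∘ Adj-sym G))
      λ w rw w≢p → blueUnlessPRY w (⊥-elim ∘ w≢p) (λ { refl → ⊥-elim (Adj-irrefl Gᶜ rw) })
                                   (λ { refl → blueY })

    zfs : IsZeroForcingSet Gᶜ Z
    zfs w = blueUnlessPRY w (λ { refl → blueP }) (λ { refl → blueR }) (λ { refl → blueY })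

-- Whichever vertex of the 4-cycle has a neighbour off it, read the cycle starting there.
fourCycle-complement-zeroForcingSet : Cactus G → (C : Cycle G) → len C ≡ 4 →
  (i : Fin (len C)) {y : Fin n} → ¬ y ∈C C → Adj G (vert C i) y →
  ∃ λ Z → IsZeroForcingSet (complement G) Z × ∣ Z ∣ ≤ n ∸ 3
fourCycle-complement-zeroForcingSet cactus C@record { path = path ; close = close } refl = λ where
  zero → cactus-complement-zeroForcingSet cactus C {# 0} {# 1} {# 2} {# 3}
    (λ ()) (λ ()) (λ ()) (λ ()) (λ ()) (λ ()) (path (# 0)) (path (# 1))
  (suc zero) → cactus-complement-zeroForcingSet cactus C {# 1} {# 2} {# 3} {# 0}
    (λ ()) (λ ()) (λ ()) (λ ()) (λ ()) (λ ()) (path (# 1)) (path (# 2))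
  (suc (suc zero)) → cactus-complement-zeroForcingSet cactus C {# 2} {# 3} {# 0} {# 1}
    (λ ()) (λ ()) (λ ()) (λ ()) (λ ()) (λ ()) (path (# 2)) close
  (suc (suc (suc zero))) → cactus-complement-zeroForcingSet cactus C {# 3} {# 0} {# 1} {# 2}
    (λ ()) (λ ()) (λ ()) (λ ()) (λ ()) (λ ()) close (path (# 0))

ZeroForcingNumber-intro : (k : ℕ) → (∃ λ B → IsZeroForcingSet H B × ∣ B ∣ ≤ k) →
  (∀ B → IsZeroForcingSet H B → k ≤ ∣ B ∣) → ZeroForcingNumber H k
ZeroForcingNumber-intro k (B , zfs , ∣B∣≤k) minimal =
  (B , zfs , ≤-antisym ∣B∣≤k (minimal B zfs)) , minimal

corollary4p7 : (n : ℕ) (G : Graph n) → Cactus G → AtLeastTwoCycles G → Has4Cycle G →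
    FourCycleCondition G → ZeroForcingNumber (complement G) (n ∸ 3)
corollary4p7 n G cactus twoCycles (C , len≡4) fcc =
  ZeroForcingNumber-intro (n ∸ 3) upper (complement-zeroForcing-lowerBound fcc)
  where
  upper : ∃ λ Z → IsZeroForcingSet (complement G) Z × ∣ Z ∣ ≤ n ∸ 3
  upper with i , y , y∉C , py ← cactus-cycleExit cactus twoCycles C =
    fourCycle-complement-zeroForcingSet cactus C len≡4 i y∉C py
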